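{- For every positive integer $n$, $$n^2-1\ \Big|\ \sum_{k=0}^{n-1}\binom{n-1}{k}\binom{ -n-1}{k}C_k3^{n-1-k}a(n,k),$$ where $$a(n,k)=4k^2n^2-8kn^3-14k^2n-14kn^2-4n^3+13k^2-11kn-26n^2+39k+4n+26.$$
   Context: $C_k=\binom{2k}{k}/(k+1)$ is the Catalan number and $\binom{x}{k}=x(x-1)\cdots(x-k+1)/k!$ for any integer $x$ and $k\in\mathbb{N}$. Divisibility by $0$ means the quantity equals $0$. -}

module Defs where

open import Data.Nat as ℕ using (ℕ; zero; suc)
open import Data.Nat.Properties using (_!≢0)
open import Data.Nat.Combinatorics using (_C_)
open import Data.Integer using (ℤ; +_; _+_; _-_; _*_; -_; 0ℤ; 1ℤ)
open import Data.Integer.DivMod using (_/ℕ_)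
open import Data.List using (map; foldr; upTo)

fallingℤ : ℤ → ℕ → ℤ
fallingℤ x zero    = 1ℤ
fallingℤ x (suc k) = fallingℤ x k * (x - + k)

-- generalized binomial coefficient  binom x k = x(x-1)...(x-k+1)/k!  (exact division)
binomℤ : ℤ → ℕ → ℤ
binomℤ x k = fallingℤ x k /ℕ (k ℕ.!)
  where instance _ = k !≢0

catalan : ℕ → ℕ
catalan k = ((2 ℕ.* k) C k) ℕ./ suc k

sumTo : ℕ → (ℕ → ℤ) → ℤ
sumTo n f = foldr _+_ 0ℤ (map f (upTo n))

aNK : ℤ → ℤ → ℤ
aNK n k = + 4 * k * k * n * n - + 8 * k * n * n * n - + 14 * k * k * n
        - + 14 * k * n * n - + 4 * n * n * n + + 13 * k * k - + 11 * k * n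
        - + 26 * n * n + + 39 * k + + 4 * n + + 26

term : ℕ → ℕ → ℤ
term n k = binomℤ (+ (n ℕ.∸ 1)) k * binomℤ (- (+ n) - 1ℤ) k * + catalan k
         * + (3 ℕ.^ (n ℕ.∸ 1 ℕ.∸ k)) * aNK (+ n) (+ k)

module Submission where

-- Every summand of the sum is already divisible by n² - 1, so
-- the sum is.  Write b₁ = binom(n-1,k) and b₂ = binom(-n-1,k).  The
-- absorption identity  k·binom(x,k) = x·binom(x-1,k-1)  gives
--   k·b₁ = (n-1)·c₁   and   k·b₂ = (-n-1)·c₂
-- for integers c₁, c₂ (take c₁ = c₂ = 0 when k = 0).  The polynomial a(n,k)
-- is arranged so that b₁·b₂·a(n,k) is a combination of
--   (n²-1)·b₁b₂,  (n-1)·b₁(kb₂),  (n+1)·(kb₁)b₂  and  (kb₁)(kb₂),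
-- and after substituting the two absorption identities each of these four
-- terms carries the factor (n-1)(n+1) = n² - 1.

open import Defs
open import Data.Nat using (ℕ; _≥_)
open import Data.Integer using (+_; _*_; _-_; 1ℤ)
open import Data.Integer.Divisibility using (_∣_)

import Data.Nat as ℕ
import Data.Nat.DivMod as ℕ
open import Data.Nat using (zero; suc; _!)
open import Data.Nat.Properties using (_!≢0)
open import Data.Integer using (ℤ; -[1+_]; _+_; -_; 0ℤ; _/ℕ_)
open import Data.Integer.Properties using (pos-*; *-cancelʳ-≡; *-zeroˡ; *-assoc; *-comm)
import Data.Integer.Divisibility.Signed as Signed
open Signed using (divides) renaming (_∣_ to _∣ₛ_)
open import Data.Integer.Tactic.RingSolver using (solve-∀)
open import Relation.Binary.PropositionalEquality
open import Data.List using (List; []; _∷_; map; foldr; upTo)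

*-/ℕ-cancel : ∀ c d .{{_ : ℕ.NonZero d}} → (c * + d) /ℕ d ≡ c
*-/ℕ-cancel (+ a) d@(suc _) =
  trans (cong (_/ℕ d) (sym (pos-* a d))) (cong +_ (ℕ.m*n/n≡m a d))
-- for a negative dividend the remainder (suc a · d) % d must be seen to be 0
*-/ℕ-cancel -[1+ a ] d@(suc _) with (suc a ℕ.* d) ℕ.% d | ℕ.m*n%n≡0 (suc a) d
... | .0 | refl = cong (λ q → - (+ q)) (ℕ.m*n/n≡m (suc a) d)

falling-0 : ∀ k → fallingℤ 0ℤ (suc k) ≡ 0ℤ
falling-0 zero    = refl
falling-0 (suc k) = trans (cong (_* (0ℤ - + suc k)) (falling-0 k)) (*-zeroˡ (0ℤ - + suc k))

falling-pascal : ∀ x k →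
  fallingℤ (1ℤ + x) (suc k) ≡ fallingℤ x (suc k) + + suc k * fallingℤ x k
falling-pascal x zero    = base x
  where
  base : ∀ x → 1ℤ * ((1ℤ + x) - + 0) ≡ 1ℤ * (x - + 0) + + 1 * 1ℤ
  base = solve-∀
falling-pascal x (suc k) =
  trans (cong (_* ((1ℤ + x) - + suc k)) (falling-pascal x k))
        (step x (fallingℤ x k) (+ k))
  where
  step : ∀ x F K → (F * (x - K) + (1ℤ + K) * F) * ((1ℤ + x) - (1ℤ + K))
                 ≡ F * (x - K) * (x - (1ℤ + K)) + (1ℤ + (1ℤ + K)) * (F * (x - K))
  step = solve-∀

falling-shift : ∀ x k → fallingℤ x (suc k) ≡ x * fallingℤ (x - 1ℤ) k
falling-shift x zero    = base x
  where
  base : ∀ x → 1ℤ * (x - + 0) ≡ x * 1ℤ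
  base = solve-∀
falling-shift x (suc k) =
  trans (cong (_* (x - + suc k)) (falling-shift x k))
        (step x (fallingℤ (x - 1ℤ) k) (+ k))
  where
  step : ∀ x F K → x * F * (x - (1ℤ + K)) ≡ x * (F * ((x - 1ℤ) - K))
  step = solve-∀

-- For k+1 this is
-- an induction on x in both directions from 0 along Pascal's rule, using
-- that (k+1)! divides (k+1)·x^{(k)} by the induction hypothesis on k.
factorial∣falling : ∀ k x → + (k !) ∣ₛ fallingℤ x k
factorial∣falling zero    x = Signed.∣-refl
factorial∣falling (suc k) = go
  where
  fact-suc : + (suc k !) ≡ + suc k * + (k !)
  fact-suc = pos-* (suc k) (k !)

  pascal-tail : ∀ x → + (suc k !) ∣ₛ + suc k * fallingℤ x k
  pascal-tail x = subst (_∣ₛ + suc k * fallingℤ x k) (sym fact-suc)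
    (Signed.*-monoʳ-∣ (+ suc k) (factorial∣falling k x))

  up : ∀ m → + (suc k !) ∣ₛ fallingℤ (+ m) (suc k)
  up zero    = divides 0ℤ (falling-0 k)
  up (suc m) = subst (+ (suc k !) ∣ₛ_) (sym (falling-pascal (+ m) k))
    (Signed.∣m∣n⇒∣m+n (up m) (pascal-tail (+ m)))

  -- uses  1 + -[1+ 0 ] = + 0  and  1 + -[1+ j+1 ] = -[1+ j ]  definitionally
  down : ∀ j → + (suc k !) ∣ₛ fallingℤ -[1+ j ] (suc k)
  down j = Signed.∣m+n∣n⇒∣m
    (subst (+ (suc k !) ∣ₛ_) (falling-pascal -[1+ j ] k) (previous j))
    (pascal-tail -[1+ j ])
    where
    previous : ∀ i → + (suc k !) ∣ₛ fallingℤ (1ℤ + -[1+ i ]) (suc k)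
    previous zero    = up zero
    previous (suc i) = down i

  go : ∀ x → + (suc k !) ∣ₛ fallingℤ x (suc k)
  go (+ m)    = up m
  go -[1+ j ] = down j

binom-exact : ∀ x k → binomℤ x k * + (k !) ≡ fallingℤ x k
binom-exact x k with factorial∣falling k x
... | divides c eq = begin
  binomℤ x k * + (k !)                    ≡⟨ cong (λ y → (y /ℕ (k !)) * + (k !)) eq ⟩
  (c * + (k !)) /ℕ (k !) * + (k !)        ≡⟨ cong (_* + (k !)) (*-/ℕ-cancel c (k !)) ⟩
  c * + (k !)                             ≡⟨ sym eq ⟩
  fallingℤ x k                            ∎
  where
  open ≡-Reasoning
  instance _ = k !≢0

binom-absorb : ∀ x k → + suc k * binomℤ x (suc k) ≡ x * binomℤ (x - 1ℤ) k
binom-absorb x k = *-cancelʳ-≡ _ _ (+ (k !)) (begin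
  + suc k * binomℤ x (suc k) * + (k !)    ≡⟨ reassoc (+ suc k) (binomℤ x (suc k)) (+ (k !)) ⟩
  binomℤ x (suc k) * (+ suc k * + (k !))  ≡⟨ cong (binomℤ x (suc k) *_) (sym (pos-* (suc k) (k !))) ⟩
  binomℤ x (suc k) * + (suc k !)          ≡⟨ binom-exact x (suc k) ⟩
  fallingℤ x (suc k)                      ≡⟨ falling-shift x k ⟩
  x * fallingℤ (x - 1ℤ) k                 ≡⟨ cong (x *_) (sym (binom-exact (x - 1ℤ) k)) ⟩
  x * (binomℤ (x - 1ℤ) k * + (k !))       ≡⟨ sym (*-assoc x _ _) ⟩
  x * binomℤ (x - 1ℤ) k * + (k !)         ∎)
  where
  open ≡-Reasoning
  instance _ = k !≢0
  reassoc : ∀ a b c → a * b * c ≡ b * (a * c)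
  reassoc = solve-∀

∣-absorbed : ∀ x k → x ∣ₛ + k * binomℤ x k
∣-absorbed x zero    = divides 0ℤ refl
∣-absorbed x (suc k) =
  divides (binomℤ (x - 1ℤ) k) (trans (binom-absorb x k) (*-comm x _))

-- The four terms into which b₁·b₂·a(n,k) splits, as a function of
-- u = k·b₁ and v = k·b₂.
split : ℤ → ℤ → ℤ → ℤ → ℤ → ℤ
split n b₁ b₂ u v = - (n * n - 1ℤ) * (+ 4 * n + + 26) * b₁ * b₂
                  + (n - 1ℤ) * (- (+ 8) * n * n - + 22 * n - + 36) * b₁ * v
                  + + 3 * (n + 1ℤ) * u * b₂
                  + (+ 4 * n * n - + 14 * n + + 13) * u * v

a-split : ∀ n k b₁ b₂ → b₁ * b₂ * aNK n k ≡ split n b₁ b₂ (k * b₁) (k * b₂)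
a-split = unfolded
  where
  -- the same identity with aNK and split unfolded, so the ring solver sees it
  unfolded : ∀ n k b₁ b₂ →
    b₁ * b₂ * (+ 4 * k * k * n * n - + 8 * k * n * n * n - + 14 * k * k * n
               - + 14 * k * n * n - + 4 * n * n * n + + 13 * k * k - + 11 * k * n
               - + 26 * n * n + + 39 * k + + 4 * n + + 26)
      ≡ - (n * n - 1ℤ) * (+ 4 * n + + 26) * b₁ * b₂
        + (n - 1ℤ) * (- (+ 8) * n * n - + 22 * n - + 36) * b₁ * (k * b₂)
        + + 3 * (n + 1ℤ) * (k * b₁) * b₂
        + (+ 4 * n * n - + 14 * n + + 13) * (k * b₁) * (k * b₂)
  unfolded = solve-∀

-- Once u is a multiple of n-1 and v a multiple of -n-1, each of the four
-- terms of the split carries the factor n² - 1.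
split-cofactor : ℤ → ℤ → ℤ → ℤ → ℤ → ℤ
split-cofactor n b₁ b₂ c₁ c₂ =
  - (+ 4 * n + + 26) * b₁ * b₂ - (- (+ 8) * n * n - + 22 * n - + 36) * b₁ * c₂
  + + 3 * c₁ * b₂ - (+ 4 * n * n - + 14 * n + + 13) * c₁ * c₂

split-factors : ∀ n b₁ b₂ c₁ c₂ →
  split n b₁ b₂ (c₁ * (n - 1ℤ)) (c₂ * (- n - 1ℤ))
    ≡ split-cofactor n b₁ b₂ c₁ c₂ * (n * n - 1ℤ)
split-factors = unfolded
  where
  unfolded : ∀ n b₁ b₂ c₁ c₂ →
    - (n * n - 1ℤ) * (+ 4 * n + + 26) * b₁ * b₂
    + (n - 1ℤ) * (- (+ 8) * n * n - + 22 * n - + 36) * b₁ * (c₂ * (- n - 1ℤ))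
    + + 3 * (n + 1ℤ) * (c₁ * (n - 1ℤ)) * b₂
    + (+ 4 * n * n - + 14 * n + + 13) * (c₁ * (n - 1ℤ)) * (c₂ * (- n - 1ℤ))
      ≡ (- (+ 4 * n + + 26) * b₁ * b₂ - (- (+ 8) * n * n - + 22 * n - + 36) * b₁ * c₂
         + + 3 * c₁ * b₂ - (+ 4 * n * n - + 14 * n + + 13) * c₁ * c₂)
        * (n * n - 1ℤ)
  unfolded = solve-∀

∣-b₁b₂a : ∀ n k b₁ b₂ → (n - 1ℤ) ∣ₛ k * b₁ → (- n - 1ℤ) ∣ₛ k * b₂ →
          (n * n - 1ℤ) ∣ₛ b₁ * b₂ * aNK n k
∣-b₁b₂a n k b₁ b₂ (divides c₁ eq₁) (divides c₂ eq₂) =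
  divides (split-cofactor n b₁ b₂ c₁ c₂) (begin
    b₁ * b₂ * aNK n k                                 ≡⟨ a-split n k b₁ b₂ ⟩
    split n b₁ b₂ (k * b₁) (k * b₂)                   ≡⟨ cong₂ (split n b₁ b₂) eq₁ eq₂ ⟩
    split n b₁ b₂ (c₁ * (n - 1ℤ)) (c₂ * (- n - 1ℤ))   ≡⟨ split-factors n b₁ b₂ c₁ c₂ ⟩
    split-cofactor n b₁ b₂ c₁ c₂ * (n * n - 1ℤ)       ∎)
  where open ≡-Reasoning

-- Each summand of the theorem's sum is divisible by n² - 1 (here n = m+1):
-- the binomials binom(m,k) and binom(-n-1,k) absorb k as required above,
-- and the remaining factors C_k·3^(n-1-k) just multiply along.
-- (Here n - 1 reduces to + m, matching the first binomial.)
∣-term : ∀ m k → (+ suc m * + suc m - 1ℤ) ∣ₛ term (suc m) k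
∣-term m k = subst (n * n - 1ℤ ∣ₛ_) (sym (regroup b₁ b₂ c p (aNK n (+ k))))
  (Signed.∣n⇒∣m*n (c * p) (∣-b₁b₂a n (+ k) b₁ b₂ (∣-absorbed (+ m) k) (∣-absorbed (- n - 1ℤ) k)))
  where
  n b₁ b₂ c p : ℤ
  n  = + suc m
  b₁ = binomℤ (+ m) k
  b₂ = binomℤ (- n - 1ℤ) k
  c  = + catalan k
  p  = + (3 ℕ.^ (m ℕ.∸ k))
  regroup : ∀ b₁ b₂ c p a → b₁ * b₂ * c * p * a ≡ c * p * (b₁ * b₂ * a)
  regroup = solve-∀

∣-sum : ∀ d (f : ℕ → ℤ) (ks : List ℕ) → (∀ k → d ∣ₛ f k) →
        d ∣ₛ foldr _+_ 0ℤ (map f ks)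
∣-sum d f []       d∣f = divides 0ℤ refl
∣-sum d f (k ∷ ks) d∣f = Signed.∣m∣n⇒∣m+n (d∣f k) (∣-sum d f ks d∣f)

lemma3p3 : (n : ℕ) → n ≥ 1 →
    (+ n * + n - 1ℤ) ∣ sumTo n (term n)
lemma3p3 (suc m) _ = Signed.∣⇒∣ᵤ (∣-sum _ (term (suc m)) (upTo (suc m)) (∣-term m))
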